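{- For every integer $q\geq 3$ and every rational number $r$ with $r>\tfrac12$, there exists $v\in\mathbb{N}$ such that \[ \frac{s_q(v^2)}{s_q(v)}=r. \]
   Context: For an integer $q\geq 2$ and $n\in\mathbb{N}$, $s_q(n)$ denotes the sum of the digits of $n$ written in base $q$. -}

module Defs where

open import Data.Nat using (ℕ; zero; suc; _+_; _≤_; NonZero)
open import Data.Nat.DivMod using (_/_; _%_)

-- Digit sum with fuel: s-aux fuel q n. With fuel ≥ n it computes the full
-- base-q digit sum of n (each step divides n by q ≥ 2, so n strictly decreases).
digitSumAux : ℕ → (q : ℕ) → .{{NonZero q}} → ℕ → ℕ
digitSumAux zero    q n = 0
digitSumAux (suc f) q zero = 0
digitSumAux (suc f) q n@(suc _) = (n % q) + digitSumAux f q (n / q)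

digitSum : (q : ℕ) → .{{NonZero q}} → ℕ → ℕ
digitSum q n = digitSumAux n q n

module Submission where

open import Defs
open import Data.Nat using (ℕ)

-- Two facts drive everything
-- (module Base, valid in every base q ≥ 2): if x < q^E then s(x + q^E y) = s(x) + s(y),
-- and the numbers q^L − 1 ("nines") satisfy s(m (q^L − 1)) = (q − 1) L for 1 ≤ m < q^L,
-- with a companion rule for m (q^L − 1) − 1.  Both follow from a general borrowing lemma
-- for q^A (Z + 1) − (u + 1).  Module Construction then builds explicit v whose digit
-- sums s(v) and s(v²) are prescribed multiples of q − 1:
--   * the borrowed number w = q^A (q^D − 1) − (q^C − 1) has s(w) = (q − 1)(A + D − C)
--     and s(w²) = (q − 1)(A + C); it realises every ratio in (1/2, 3/2);
--   * a chain puts n blocks of nines of increasing lengths on top of such a seed, so far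
--     apart that all partial products of v² are separated; each cross term contributes
--     (q − 1) times a block length, which lifts the ratio to any value ≥ 3/2.
-- Writing 2a = e + Q b with 0 ≤ e < b, the quotient Q selects the construction and the
-- free parameters solve s(v) : s(v²) = b : a exactly.

module DigitSums where
  open import Data.Nat
  open import Data.Nat.Properties
  open import Data.Nat.DivMod
  open import Data.Nat.Tactic.RingSolver using (solve-∀)
  open import Data.Empty using (⊥-elim)
  open import Relation.Binary.PropositionalEquality

  module Base (b : ℕ) where

    q : ℕ
    q = suc (suc b)

    k : ℕ
    k = suc b

    s : ℕ → ℕ
    s = digitSum q

    q^-nonZero : ∀ L → NonZero (q ^ L)
    q^-nonZero L = >-nonZero (m^n>0 q L)

    private
      quotient-decreases : ∀ n → suc n / q ≤ n
      quotient-decreases n = ≤-pred (m/n<m (suc n) q (s≤s (s≤s z≤n)))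

    digitSumAux-fuel : ∀ f g n → n ≤ f → n ≤ g → digitSumAux f q n ≡ digitSumAux g q n
    digitSumAux-fuel zero    zero    zero    _         _         = refl
    digitSumAux-fuel zero    (suc g) zero    _         _         = refl
    digitSumAux-fuel (suc f) zero    zero    _         _         = refl
    digitSumAux-fuel (suc f) (suc g) zero    _         _         = refl
    digitSumAux-fuel (suc f) (suc g) (suc n) (s≤s n≤f) (s≤s n≤g) =
      cong (suc n % q +_) (digitSumAux-fuel f g (suc n / q) (≤-trans lt n≤f) (≤-trans lt n≤g))
      where
      lt : suc n / q ≤ n
      lt = quotient-decreases n

    digitSum-step : ∀ n → s n ≡ n % q + s (n / q)
    digitSum-step zero    = refl
    digitSum-step (suc n) =
      cong (suc n % q +_) (digitSumAux-fuel n (suc n / q) (suc n / q) (quotient-decreases n) ≤-refl)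

    digit-decomposition : ∀ n → n ≡ n % q + q * (n / q)
    digit-decomposition n = trans (m≡m%n+[m/n]*n n q) (cong (n % q +_) (*-comm (n / q) q))

    %-digit : ∀ {d} m → d < q → (d + q * m) % q ≡ d
    %-digit {d} m d<q = begin
      (d + q * m) % q ≡⟨ cong (λ t → (d + t) % q) (*-comm q m) ⟩
      (d + m * q) % q ≡⟨ [m+kn]%n≡m%n d m q ⟩
      d % q           ≡⟨ m<n⇒m%n≡m d<q ⟩
      d               ∎
      where open ≡-Reasoning

    /-digit : ∀ {d} m → d < q → (d + q * m) / q ≡ m
    /-digit {d} m d<q = *-cancelˡ-≡ _ m q (+-cancelˡ-≡ d _ _ (begin
      d + q * ((d + q * m) / q)                 ≡⟨ cong (_+ q * ((d + q * m) / q)) (sym (%-digit m d<q)) ⟩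
      (d + q * m) % q + q * ((d + q * m) / q)   ≡⟨ sym (digit-decomposition (d + q * m)) ⟩
      d + q * m                                 ∎))
      where open ≡-Reasoning

    digitSum-digit : ∀ {d} m → d < q → s (d + q * m) ≡ d + s m
    digitSum-digit {d} m d<q = begin
      s (d + q * m)                               ≡⟨ digitSum-step (d + q * m) ⟩
      (d + q * m) % q + s ((d + q * m) / q)       ≡⟨ cong₂ _+_ (%-digit m d<q) (cong s (/-digit m d<q)) ⟩
      d + s m                                     ∎
      where open ≡-Reasoning

    quotient-bound : ∀ L {x} → x < q ^ suc L → x / q < q ^ L
    quotient-bound L {x} x< = *-cancelˡ-< q (x / q) (q ^ L) (begin-strict
      q * (x / q)              ≤⟨ m≤n+m (q * (x / q)) (x % q) ⟩
      x % q + q * (x / q)      ≡⟨ sym (digit-decomposition x) ⟩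
      x                        <⟨ x< ⟩
      q ^ suc L                ∎)
      where open ≤-Reasoning

    digitSum-concat : ∀ E x y → x < q ^ E → s (x + q ^ E * y) ≡ s x + s y
    digitSum-concat zero    zero    y _         = cong s (+-identityʳ y)
    digitSum-concat zero    (suc x) y (s≤s ())
    digitSum-concat (suc E) x       y x<        = begin
      s (x + q ^ suc E * y)          ≡⟨ cong s shift ⟩
      s (d + q * (x' + q ^ E * y))   ≡⟨ digitSum-digit (x' + q ^ E * y) (m%n<n x q) ⟩
      d + s (x' + q ^ E * y)         ≡⟨ cong (d +_) (digitSum-concat E x' y (quotient-bound E x<)) ⟩
      d + (s x' + s y)               ≡⟨ sym (+-assoc d (s x') (s y)) ⟩
      d + s x' + s y                 ≡⟨ cong (_+ s y) (sym (digitSum-step x)) ⟩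
      s x + s y                      ∎
      where
      open ≡-Reasoning
      d x' : ℕ
      d = x % q
      x' = x / q
      shift : x + q ^ suc E * y ≡ d + q * (x' + q ^ E * y)
      shift = begin
        x + q * q ^ E * y                 ≡⟨ cong (_+ q * q ^ E * y) (digit-decomposition x) ⟩
        d + q * x' + q * q ^ E * y        ≡⟨ regroup d q x' (q ^ E) y ⟩
        d + q * (x' + q ^ E * y)          ∎
        where
        regroup : ∀ d q x p y → d + q * x + q * p * y ≡ d + q * (x + p * y)
        regroup = solve-∀

    -- Complement: if x + y = q^L - 1 then the digits of x and y pair up to q - 1 each.
    digitSum-complement : ∀ L x y → suc (x + y) ≡ q ^ L → s x + s y ≡ k * L
    digitSum-complement zero    zero    zero    _  = sym (*-zeroʳ k)
    digitSum-complement zero    zero    (suc y) ()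
    digitSum-complement zero    (suc x) y       ()
    digitSum-complement (suc L) x       y       eq = begin
      s x + s y                           ≡⟨ cong₂ _+_ (digitSum-step x) (cong s y-digits) ⟩
      (d + s x') + s ((k ∸ d) + q * y')   ≡⟨ cong ((d + s x') +_) (digitSum-digit y' (s≤s (m∸n≤m k d))) ⟩
      (d + s x') + ((k ∸ d) + s y')       ≡⟨ +-exchange d (s x') (k ∸ d) (s y') ⟩
      (d + (k ∸ d)) + (s x' + s y')       ≡⟨ cong₂ _+_ (m+[n∸m]≡n d≤k) (digitSum-complement L x' y' eq') ⟩
      k + k * L                           ≡⟨ sym (*-suc k L) ⟩
      k * suc L                           ∎
      where
      open ≡-Reasoning
      d x' y' : ℕ
      d = x % q
      x' = x / q
      d≤k : d ≤ k
      d≤k = ≤-pred (m%n<n x q)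
      x'< : x' < q ^ L
      x'< = quotient-bound L (≤-trans (s≤s (m≤m+n x y)) (≤-reflexive eq))
      -- the digits of y above the last one form the complement of x' below q^L
      y' = q ^ L ∸ suc x'
      eq' : suc (x' + y') ≡ q ^ L
      eq' = m+[n∸m]≡n x'<
      y-digits : y ≡ (k ∸ d) + q * y'
      y-digits = +-cancelˡ-≡ (suc x) y _ (begin
        suc x + y                              ≡⟨ eq ⟩
        q * q ^ L                              ≡⟨ cong (q *_) (sym eq') ⟩
        q * suc (x' + y')                      ≡⟨ spread q x' y' ⟩
        suc k + (q * x' + q * y')              ≡⟨ cong (λ t → suc t + (q * x' + q * y')) (sym (m+[n∸m]≡n d≤k)) ⟩
        suc (d + (k ∸ d)) + (q * x' + q * y')  ≡⟨ regroup d (k ∸ d) (q * x') (q * y') ⟩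
        suc (d + q * x') + ((k ∸ d) + q * y')  ≡⟨ cong (λ t → suc t + ((k ∸ d) + q * y')) (sym (digit-decomposition x)) ⟩
        suc x + ((k ∸ d) + q * y')             ∎)
        where
        spread : ∀ q x y → q * suc (x + y) ≡ q + (q * x + q * y)
        spread = solve-∀
        regroup : ∀ d e a c → suc (d + e) + (a + c) ≡ suc (d + a) + (e + c)
        regroup = solve-∀
      +-exchange : ∀ a b c d → (a + b) + (c + d) ≡ (a + c) + (b + d)
      +-exchange = solve-∀

    -- Borrowing: if N + (u + 1) = q^A (Z + 1) with u < q^A, then N consists of the
    -- complement of u in its lowest A digits and of the digits of Z above them.
    digitSum-borrow : ∀ A N u Z → N + suc u ≡ q ^ A * suc Z → suc u ≤ q ^ A →
                      s N + s u ≡ k * A + s Z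
    digitSum-borrow A N u Z eq u< = begin
      s N + s u                 ≡⟨ cong (λ t → s t + s u) N-digits ⟩
      s (y + q ^ A * Z) + s u   ≡⟨ cong (_+ s u) (digitSum-concat A y Z y<) ⟩
      s y + s Z + s u           ≡⟨ swap (s y) (s Z) (s u) ⟩
      s y + s u + s Z           ≡⟨ cong (_+ s Z) (digitSum-complement A y u y-complement) ⟩
      k * A + s Z               ∎
      where
      open ≡-Reasoning
      swap : ∀ a b c → a + b + c ≡ a + c + b
      swap = solve-∀
      y : ℕ
      y = q ^ A ∸ suc u
      y+u : y + suc u ≡ q ^ A
      y+u = m∸n+n≡m u<
      y-complement : suc (y + u) ≡ q ^ A
      y-complement = trans (sym (+-suc y u)) y+u
      y< : y < q ^ A
      y< = ≤-trans (s≤s (m≤m+n y u)) (≤-reflexive y-complement)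
      N-digits : N ≡ y + q ^ A * Z
      N-digits = +-cancelʳ-≡ (suc u) N _ (begin
        N + suc u                  ≡⟨ eq ⟩
        q ^ A * suc Z              ≡⟨ *-suc (q ^ A) Z ⟩
        q ^ A + q ^ A * Z          ≡⟨ cong (_+ q ^ A * Z) (sym y+u) ⟩
        y + suc u + q ^ A * Z      ≡⟨ swap y (suc u) (q ^ A * Z) ⟩
        y + q ^ A * Z + suc u      ∎)

    two≤q^ : ∀ L → 1 ≤ L → 2 ≤ q ^ L
    two≤q^ L 1≤L = ≤-trans (s≤s (s≤s z≤n)) (^-monoʳ-≤ q 1≤L)

    -- For L ≥ 1, nines L = q^L − 1 is the L-digit number all of whose digits are q − 1.
    -- It is written as a successor so that it is visibly positive.
    nines : ℕ → ℕ
    nines L = suc (q ^ L ∸ 2)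

    suc-nines : ∀ L → 1 ≤ L → suc (nines L) ≡ q ^ L
    suc-nines L 1≤L = trans (+-comm 2 (q ^ L ∸ 2)) (m∸n+n≡m (two≤q^ L 1≤L))

    nines-bound : ∀ L → 1 ≤ L → nines L < q ^ L
    nines-bound L 1≤L = ≤-reflexive (suc-nines L 1≤L)

    digitSum-nines : ∀ L → 1 ≤ L → s (nines L) ≡ k * L
    digitSum-nines L 1≤L =
      trans (sym (+-identityʳ (s (nines L))))
            (digitSum-complement L (nines L) 0 (trans (cong suc (+-identityʳ (nines L))) (suc-nines L 1≤L)))

    -- q^L − 2 is the complement of 1, so its digit sum is (q − 1)L − 1.
    digitSum-pred-nines : ∀ L → 1 ≤ L → s (pred (nines L)) + 1 ≡ k * L
    digitSum-pred-nines L 1≤L =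
      digitSum-complement L (pred (nines L)) 1 (trans (cong suc (+-comm (pred (nines L)) 1)) (suc-nines L 1≤L))

    nines-multiple : ∀ L m → 1 ≤ L → m * nines L + m ≡ q ^ L * m
    nines-multiple L m 1≤L = begin
      m * nines L + m        ≡⟨ +-comm (m * nines L) m ⟩
      m + m * nines L        ≡⟨ sym (*-suc m (nines L)) ⟩
      m * suc (nines L)      ≡⟨ cong (m *_) (suc-nines L 1≤L) ⟩
      m * q ^ L              ≡⟨ *-comm m (q ^ L) ⟩
      q ^ L * m              ∎
      where open ≡-Reasoning

    digitSum-multiple : ∀ L {m} → 1 ≤ m → m < q ^ L → s (m * nines L) ≡ k * L
    digitSum-multiple zero    {suc m} _ (s≤s ())
    digitSum-multiple (suc L) {suc m} _ m< =
      +-cancelʳ-≡ (s m) _ _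
        (digitSum-borrow (suc L) (suc m * nines (suc L)) m m (nines-multiple (suc L) (suc m) (s≤s z≤n)) (<⇒≤ m<))

    -- If subtracting 1 from m causes no borrow, neither does subtracting 1 from
    -- m (q^L − 1), whose digit sum therefore drops to (q − 1)L − 1.
    digitSum-pred-multiple : ∀ L {m} → 1 ≤ m → m < q ^ L → s (pred m) + 1 ≡ s m →
                             s (pred (m * nines L)) + 1 ≡ k * L
    digitSum-pred-multiple zero    {suc m} _ (s≤s ())
    digitSum-pred-multiple (suc L) {suc m} _ m< no-borrow = +-cancelʳ-≡ (s m) _ _ (begin
      s N + 1 + s m        ≡⟨ +-assoc (s N) 1 (s m) ⟩
      s N + (1 + s m)      ≡⟨ cong (s N +_) (trans (+-comm 1 (s m)) no-borrow) ⟩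
      s N + s (suc m)      ≡⟨ digitSum-borrow (suc L) N (suc m) m eq m< ⟩
      k * suc L + s m      ∎)
      where
      open ≡-Reasoning
      N : ℕ
      N = pred (suc m * nines (suc L))
      eq : N + suc (suc m) ≡ q ^ suc L * suc m
      eq = trans (+-suc N (suc m)) (nines-multiple (suc L) (suc m) (s≤s z≤n))

    double-bound : ∀ L {x} → x < q ^ L → 2 * x < q ^ suc L
    double-bound L {x} x< = begin-strict
      2 * x       <⟨ *-monoʳ-< 2 x< ⟩
      2 * q ^ L   ≤⟨ *-monoˡ-≤ (q ^ L) {2} {q} (s≤s (s≤s z≤n)) ⟩
      q * q ^ L   ∎
      where open ≤-Reasoning

    product-bound : ∀ E L {x y} → x < q ^ E → y < q ^ L → x * y < q ^ (E + L)
    product-bound E L x< y< = ≤-trans (*-mono-< x< y<) (≤-reflexive (sym (^-distribˡ-+-* q E L)))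

    place-bound : ∀ E L {x y} → x < q ^ E → y < q ^ L → x + q ^ E * y < q ^ (E + L)
    place-bound E L {x} {y} x< y< = begin-strict
      x + q ^ E * y       <⟨ +-monoˡ-< (q ^ E * y) x< ⟩
      q ^ E + q ^ E * y   ≡⟨ sym (*-suc (q ^ E) y) ⟩
      q ^ E * suc y       ≤⟨ *-monoʳ-≤ (q ^ E) y< ⟩
      q ^ E * q ^ L       ≡⟨ sym (^-distribˡ-+-* q E L) ⟩
      q ^ (E + L)         ∎
      where open ≤-Reasoning

  tri : ℕ → ℕ
  tri zero    = 0
  tri (suc i) = tri i + suc i

  squares : ℕ → ℕ
  squares zero    = 0
  squares (suc i) = squares i + suc i * suc i

  double-tri : ∀ n → 2 * tri n ≡ n * (n + 1)
  double-tri zero    = refl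
  double-tri (suc n) = begin
    2 * (tri n + suc n)            ≡⟨ *-distribˡ-+ 2 (tri n) (suc n) ⟩
    2 * tri n + 2 * suc n          ≡⟨ cong (_+ 2 * suc n) (double-tri n) ⟩
    n * (n + 1) + 2 * suc n        ≡⟨ step n ⟩
    suc n * (suc n + 1)            ∎
    where
    open ≡-Reasoning
    step : ∀ n → n * (n + 1) + 2 * suc n ≡ suc n * (suc n + 1)
    step = solve-∀

  tri-bound : ∀ n → tri n ≤ n * n
  tri-bound zero    = z≤n
  tri-bound (suc n) = begin
    tri n + suc n                  ≤⟨ +-monoˡ-≤ (suc n) (tri-bound n) ⟩
    n * n + suc n                  ≤⟨ m≤m+n (n * n + suc n) n ⟩
    n * n + suc n + n              ≡⟨ step n ⟩
    suc n * suc n                  ∎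
    where
    open ≤-Reasoning
    step : ∀ n → n * n + suc n + n ≡ suc n * suc n
    step = solve-∀

  squares-bound : ∀ n → squares n ≤ n * n * n
  squares-bound zero    = z≤n
  squares-bound (suc n) = begin
    squares n + suc n * suc n                       ≤⟨ +-monoˡ-≤ (suc n * suc n) (squares-bound n) ⟩
    n * n * n + suc n * suc n                       ≤⟨ m≤m+n (n * n * n + suc n * suc n) (2 * n * n + n) ⟩
    n * n * n + suc n * suc n + (2 * n * n + n)     ≡⟨ step n ⟩
    suc n * suc n * suc n                           ∎
    where
    open ≤-Reasoning
    step : ∀ n → n * n * n + suc n * suc n + (2 * n * n + n) ≡ suc n * suc n * suc n
    step = solve-∀

  -- Explicit constructions in base q = c + 3, where 2 is still a digit.
  module Construction (c : ℕ) where
    open Base (suc c)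

    two<q^ : ∀ L → 1 ≤ L → 2 < q ^ L
    two<q^ L 1≤L = ≤-trans (s≤s (s≤s (s≤s z≤n))) (^-monoʳ-≤ q 1≤L)

    record Witness (a b : ℕ) : Set where
      field
        v z         : ℕ
        z-pos       : 1 ≤ z
        digitSum-v  : s v ≡ k * (b * z)
        digitSum-v² : s (v * v) ≡ k * (a * z)

    module Borrowed (A C D : ℕ) (1≤C : 1 ≤ C) (C<D : C < D) (room : D + C + 1 ≤ A) where
      1≤D : 1 ≤ D
      1≤D = ≤-trans 1≤C (<⇒≤ C<D)

      P nC nD : ℕ
      P = q ^ A
      nC = nines C
      nD = nines D

      C≤A : C ≤ A
      C≤A = ≤-trans (m≤n+m C D) (≤-trans (m≤m+n (D + C) 1) room)

      nC<P : nC < P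
      nC<P = ≤-trans (nines-bound C 1≤C) (^-monoʳ-≤ q C≤A)

      w : ℕ
      w = P * nD ∸ nC

      w-spec : w + nC ≡ P * nD
      w-spec = m∸n+n≡m (≤-trans (<⇒≤ nC<P) (m≤m*n P nD))

      w-pos : 1 ≤ w
      w-pos = +-cancelʳ-< nC 0 w (≤-trans nC<P (≤-trans (m≤m*n P nD) (≤-reflexive (sym w-spec))))

      w-bound : w < q ^ (A + D)
      w-bound = begin-strict
        w              ≤⟨ m≤m+n w nC ⟩
        w + nC         ≡⟨ w-spec ⟩
        P * nD         <⟨ *-monoʳ-< P {{q^-nonZero A}} (nines-bound D 1≤D) ⟩
        P * q ^ D      ≡⟨ sym (^-distribˡ-+-* q A D) ⟩
        q ^ (A + D)    ∎
        where open ≤-Reasoning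

      -- w = q^A (q^D − 1) − (q^C − 1): the subtraction borrows C times.
      digitSum-w : s w + k * C ≡ k * (A + D)
      digitSum-w = begin
        s w + k * C                    ≡⟨ cong (s w +_) (sym (digitSum-pred-nines C 1≤C)) ⟩
        s w + (s (pred nC) + 1)        ≡⟨ sym (+-assoc (s w) (s (pred nC)) 1) ⟩
        s w + s (pred nC) + 1          ≡⟨ cong (_+ 1) (digitSum-borrow A w (pred nC) (pred nD) w-spec (<⇒≤ nC<P)) ⟩
        k * A + s (pred nD) + 1        ≡⟨ +-assoc (k * A) (s (pred nD)) 1 ⟩
        k * A + (s (pred nD) + 1)      ≡⟨ cong (k * A +_) (digitSum-pred-nines D 1≤D) ⟩
        k * A + k * D                  ≡⟨ sym (*-distribˡ-+ k A D) ⟩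
        k * (A + D)                    ∎
        where open ≡-Reasoning

      cross : ℕ
      cross = 2 * nC * nD

      cross-bound : cross < P
      cross-bound = ≤-trans (product-bound (suc C) D (double-bound C (nines-bound C 1≤C)) (nines-bound D 1≤D))
                            (^-monoʳ-≤ q (≤-trans (≤-reflexive (reorder C D)) room))
        where
        reorder : ∀ c d → suc c + d ≡ d + c + 1
        reorder = solve-∀

      T : ℕ
      T = P * (nD * nD) ∸ cross

      T-spec : T + cross ≡ P * (nD * nD)
      T-spec = m∸n+n≡m (≤-trans (<⇒≤ cross-bound) (m≤m*n P (nD * nD)))

      square-expansion : w * w ≡ nC * nC + P * T
      square-expansion = +-cancelʳ-≡ (2 * nC * w + nC * nC) _ _ (begin
        w * w + (2 * nC * w + nC * nC)           ≡⟨ binomial w nC ⟩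
        (w + nC) * (w + nC)                      ≡⟨ cong₂ _*_ w-spec w-spec ⟩
        (P * nD) * (P * nD)                      ≡⟨ regroup P nD ⟩
        P * (P * (nD * nD))                      ≡⟨ cong (P *_) (sym T-spec) ⟩
        P * (T + 2 * nC * nD)                    ≡⟨ distribute P T nC nD ⟩
        P * T + 2 * nC * (P * nD)                ≡⟨ cong (λ t → P * T + 2 * nC * t) (sym w-spec) ⟩
        P * T + 2 * nC * (w + nC)                ≡⟨ collect P T nC w ⟩
        nC * nC + P * T + (2 * nC * w + nC * nC) ∎)
        where
        open ≡-Reasoning
        binomial : ∀ w c → w * w + (2 * c * w + c * c) ≡ (w + c) * (w + c)
        binomial = solve-∀
        regroup : ∀ p d → (p * d) * (p * d) ≡ p * (p * (d * d))
        regroup = solve-∀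
        distribute : ∀ p t c d → p * (t + 2 * c * d) ≡ p * t + 2 * c * (p * d)
        distribute = solve-∀
        collect : ∀ p t c w → p * t + 2 * c * (w + c) ≡ c * c + p * t + (2 * c * w + c * c)
        collect = solve-∀

      low-square-bound : nC * nC < P
      low-square-bound = ≤-trans (product-bound C C (nines-bound C 1≤C) (nines-bound C 1≤C))
                                 (^-monoʳ-≤ q (≤-trans (+-monoˡ-≤ C (<⇒≤ C<D)) (≤-trans (m≤m+n (D + C) 1) room)))

      -- T = q^A nD² − 2 nC nD borrows with u = 2 nC nD − 1 and Z = nD² − 1; as 2 nC nD
      -- and nD² end in a nonzero digit, both have digit sum (q − 1)D − 1 and cancel.
      digitSum-T : s T ≡ k * A
      digitSum-T = +-cancelʳ-≡ (k * D) _ _ (begin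
        s T + k * D                          ≡⟨ cong (s T +_) (sym cross-pred) ⟩
        s T + (s (pred cross) + 1)           ≡⟨ sym (+-assoc (s T) (s (pred cross)) 1) ⟩
        s T + s (pred cross) + 1             ≡⟨ cong (_+ 1) (digitSum-borrow A T (pred cross) (pred (nD * nD)) T-spec (<⇒≤ cross-bound)) ⟩
        k * A + s (pred (nD * nD)) + 1       ≡⟨ +-assoc (k * A) (s (pred (nD * nD))) 1 ⟩
        k * A + (s (pred (nD * nD)) + 1)     ≡⟨ cong (k * A +_) square-pred ⟩
        k * A + k * D                        ∎)
        where
        open ≡-Reasoning
        2nC<q^D : 2 * nC < q ^ D
        2nC<q^D = ≤-trans (double-bound C (nines-bound C 1≤C)) (^-monoʳ-≤ q C<D)
        no-borrow-2nC : s (pred (2 * nC)) + 1 ≡ s (2 * nC)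
        no-borrow-2nC = trans (digitSum-pred-multiple C (s≤s z≤n) (two<q^ C 1≤C) refl)
                              (sym (digitSum-multiple C (s≤s z≤n) (two<q^ C 1≤C)))
        cross-pred : s (pred cross) + 1 ≡ k * D
        cross-pred = digitSum-pred-multiple D (s≤s z≤n) 2nC<q^D no-borrow-2nC
        square-pred : s (pred (nD * nD)) + 1 ≡ k * D
        square-pred = digitSum-pred-multiple D (s≤s z≤n) (nines-bound D 1≤D)
                        (trans (digitSum-pred-nines D 1≤D) (sym (digitSum-nines D 1≤D)))

      digitSum-w² : s (w * w) ≡ k * (A + C)
      digitSum-w² = begin
        s (w * w)                ≡⟨ cong s square-expansion ⟩
        s (nC * nC + P * T)      ≡⟨ digitSum-concat A (nC * nC) T low-square-bound ⟩
        s (nC * nC) + s T        ≡⟨ cong₂ _+_ (digitSum-multiple C (s≤s z≤n) (nines-bound C 1≤C)) digitSum-T ⟩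
        k * C + k * A            ≡⟨ +-comm (k * C) (k * A) ⟩
        k * A + k * C            ≡⟨ sym (*-distribˡ-+ k A C) ⟩
        k * (A + C)              ∎
        where open ≡-Reasoning

    borrowed-witness : ∀ A C D {a b z} → 1 ≤ C → C < D → D + C + 1 ≤ A → 1 ≤ z →
                       A + D ≡ b * z + C → A + C ≡ a * z → Witness a b
    borrowed-witness A C D {a} {b} {z} 1≤C C<D room z-pos digits-v digits-v² = record
      { v = w ; z = z ; z-pos = z-pos
      ; digitSum-v = +-cancelʳ-≡ (k * C) _ _ (begin
          s w + k * C         ≡⟨ digitSum-w ⟩
          k * (A + D)         ≡⟨ cong (k *_) digits-v ⟩
          k * (b * z + C)     ≡⟨ *-distribˡ-+ k (b * z) C ⟩
          k * (b * z) + k * C ∎)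
      ; digitSum-v² = trans digitSum-w² (cong (k *_) digits-v²)
      }
      where
      open Borrowed A C D 1≤C C<D room
      open ≡-Reasoning

    -- 1/2 < a/b < 1, written as 2a = e + b with 0 < e < b.
    witness-below : ∀ e₀ f₀ a → 2 * a ≡ suc e₀ + 1 * (suc e₀ + suc f₀) → Witness a (suc e₀ + suc f₀)
    witness-below e₀ f₀ a half = borrowed-witness A 1 D (s≤s z≤n) (m≤n+m 2 (5 * f)) room (s≤s z≤n)
      (digits-v e₀ f) (begin
        A + 1                              ≡⟨ digits-v² e₀ f ⟩
        5 * (suc e₀ + 1 * (suc e₀ + f))    ≡⟨ cong (5 *_) (sym half) ⟩
        5 * (2 * a)                        ≡⟨ scale a ⟩
        a * 10                             ∎)
      where
      open ≡-Reasoning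
      f D A : ℕ
      f = suc f₀
      D = 5 * f + 2
      A = 10 * e₀ + 5 * f + 9
      room : D + 1 + 1 ≤ A
      room = ≤-trans (m≤m+n (D + 1 + 1) (10 * e₀ + 5)) (≤-reflexive (size e₀ f))
        where
        size : ∀ e f → 5 * f + 2 + 1 + 1 + (10 * e + 5) ≡ 10 * e + 5 * f + 9
        size = solve-∀
      digits-v : ∀ e f → 10 * e + 5 * f + 9 + (5 * f + 2) ≡ (suc e + f) * 10 + 1
      digits-v = solve-∀
      digits-v² : ∀ e f → 10 * e + 5 * f + 9 + 1 ≡ 5 * (suc e + 1 * (suc e + f))
      digits-v² = solve-∀
      scale : ∀ a → 5 * (2 * a) ≡ a * 10
      scale = solve-∀

    -- 1 ≤ a/b < 3/2, written as 2a = e + 2b with 0 ≤ e < b.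
    witness-middle : ∀ e f₀ a → 2 * a ≡ e + 2 * (e + suc f₀) → Witness a (e + suc f₀)
    witness-middle e f₀ a half = borrowed-witness A C (suc C) (s≤s z≤n) ≤-refl room (s≤s z≤n)
      (digits-v e f₀) (begin
        A + C                        ≡⟨ digits-v² e f₀ ⟩
        5 * (e + 2 * (e + suc f₀))   ≡⟨ cong (5 *_) (sym half) ⟩
        5 * (2 * a)                  ≡⟨ scale a ⟩
        a * 10                       ∎)
      where
      open ≡-Reasoning
      C A : ℕ
      C = suc (5 * e)
      A = 10 * e + 10 * f₀ + 9
      room : suc C + C + 1 ≤ A
      room = ≤-trans (m≤m+n (suc C + C + 1) (10 * f₀ + 5)) (≤-reflexive (size e f₀))
        where
        size : ∀ e f → suc (suc (5 * e)) + suc (5 * e) + 1 + (10 * f + 5) ≡ 10 * e + 10 * f + 9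
        size = solve-∀
      digits-v : ∀ e f → 10 * e + 10 * f + 9 + suc (suc (5 * e)) ≡ (e + suc f) * 10 + suc (5 * e)
      digits-v = solve-∀
      digits-v² : ∀ e f → 10 * e + 10 * f + 9 + suc (5 * e) ≡ 5 * (e + 2 * (e + suc f))
      digits-v² = solve-∀
      scale : ∀ a → 5 * (2 * a) ≡ a * 10
      scale = solve-∀

    -- Chains: on top of a seed w, place n blocks of q − 1 digits with lengths
    -- M + 1, ..., M + n, so far apart that no two products in the square overlap.
    module Chain (w x y M n : ℕ) (w-pos : 1 ≤ w) (w< : w < q ^ M)
                 (digitSum-seed : s w ≡ k * x) (digitSum-seed² : s (w * w) ≡ k * y) where
      Lb : ℕ
      Lb = M + n

      ℓ : ℕ → ℕ
      ℓ i = suc (M + i)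

      ℓ-bound : ∀ {i} → i < n → ℓ i ≤ Lb
      ℓ-bound {i} i<n = ≤-trans (≤-reflexive (sym (+-suc M i))) (+-monoʳ-≤ M i<n)

      -- build i < q ^ G i, and block i sits at position E i
      G E : ℕ → ℕ
      G zero    = Lb
      G (suc i) = E i + Lb
      E i = G i + G i + suc Lb

      build : ℕ → ℕ
      build zero    = w
      build (suc i) = build i + q ^ E i * nines (ℓ i)

      build-bound : ∀ i → i ≤ n → build i < q ^ G i
      build-below : ∀ i → i ≤ n → build i < q ^ E i

      build-bound zero    _    = ≤-trans w< (^-monoʳ-≤ q (m≤m+n M n))
      build-bound (suc i) i<n  =
        ≤-trans (place-bound (E i) (ℓ i) (build-below i (<⇒≤ i<n)) (nines-bound (ℓ i) (s≤s z≤n)))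
                (^-monoʳ-≤ q (+-monoʳ-≤ (E i) (ℓ-bound i<n)))
      build-below i i≤n = ≤-trans (build-bound i i≤n) (^-monoʳ-≤ q (≤-trans (m≤m+n (G i) (G i)) (m≤m+n (G i + G i) (suc Lb))))

      square-bound : ∀ i → i ≤ n → build i * build i < q ^ E i
      square-bound i i≤n = ≤-trans (product-bound (G i) (G i) (build-bound i i≤n) (build-bound i i≤n))
                                   (^-monoʳ-≤ q (m≤m+n (G i + G i) (suc Lb)))

      cross-bound : ∀ j L → j ≤ n → 1 ≤ L → L ≤ Lb → 2 * build j * nines L < q ^ E j
      cross-bound j L j≤n 1≤L L≤Lb =
        ≤-trans (product-bound (suc (G j)) L (double-bound (G j) (build-bound j j≤n)) (nines-bound L 1≤L))
                (^-monoʳ-≤ q (≤-trans (+-monoʳ-≤ (suc (G j)) L≤Lb)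
                             (≤-trans (≤-reflexive (sym (+-suc (G j) Lb)))
                                      (+-monoˡ-≤ (suc Lb) (m≤m+n (G j) (G j))))))

      digitSum-build : ∀ i → i ≤ n → s (build i) ≡ k * (x + i * M + tri i)
      digitSum-build zero    _   = trans digitSum-seed (cong (k *_) (sym (trans (+-identityʳ (x + 0)) (+-identityʳ x))))
      digitSum-build (suc i) i<n = begin
        s (build i + q ^ E i * nines (ℓ i))         ≡⟨ digitSum-concat (E i) (build i) (nines (ℓ i)) (build-below i (<⇒≤ i<n)) ⟩
        s (build i) + s (nines (ℓ i))               ≡⟨ cong₂ _+_ (digitSum-build i (<⇒≤ i<n)) (digitSum-nines (ℓ i) (s≤s z≤n)) ⟩
        k * (x + i * M + tri i) + k * ℓ i           ≡⟨ step k x i M (tri i) ⟩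
        k * (x + suc i * M + tri (suc i))           ∎
        where
        open ≡-Reasoning
        step : ∀ k x i M t → k * (x + i * M + t) + k * suc (M + i) ≡ k * (x + suc i * M + (t + suc i))
        step = solve-∀

      digitSum-cross : ∀ j L → M + j < L → L ≤ Lb → s (2 * build j * nines L) ≡ suc j * (k * L)
      digitSum-cross zero    L M<L L≤Lb =
        trans (digitSum-multiple L (≤-trans w-pos (m≤m+n w (w + 0)))
                                   (≤-trans (double-bound M w<) (^-monoʳ-≤ q (≤-trans (s≤s (≤-reflexive (sym (+-identityʳ M)))) M<L))))
              (sym (*-identityˡ (k * L)))
      digitSum-cross (suc j) L M+j<L L≤Lb = begin
        s (2 * (build j + q ^ E j * H) * nines L)                      ≡⟨ cong s (expand (build j) (q ^ E j) H (nines L)) ⟩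
        s (2 * build j * nines L + q ^ E j * (2 * H * nines L))        ≡⟨ digitSum-concat (E j) _ _ (cross-bound j L j≤n 1≤L L≤Lb) ⟩
        s (2 * build j * nines L) + s (2 * H * nines L)                ≡⟨ cong₂ _+_ (digitSum-cross j L M+j<L' L≤Lb) (digitSum-multiple L (s≤s z≤n) 2H<q^L) ⟩
        suc j * (k * L) + k * L                                        ≡⟨ +-comm (suc j * (k * L)) (k * L) ⟩
        suc (suc j) * (k * L)                                          ∎
        where
        open ≡-Reasoning
        H : ℕ
        H = nines (ℓ j)
        expand : ∀ b p h d → 2 * (b + p * h) * d ≡ 2 * b * d + p * (2 * h * d)
        expand = solve-∀
        M+j<L' : M + j < L
        M+j<L' = ≤-trans (s≤s (+-monoʳ-≤ M (n≤1+n j))) M+j<L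
        j≤n : j ≤ n
        j≤n = <⇒≤ (+-cancelˡ-< M j n (≤-trans M+j<L' L≤Lb))
        1≤L : 1 ≤ L
        1≤L = ≤-trans (s≤s z≤n) M+j<L
        2H<q^L : 2 * H < q ^ L
        2H<q^L = ≤-trans (double-bound (ℓ j) (nines-bound (ℓ j) (s≤s z≤n)))
                         (^-monoʳ-≤ q (≤-trans (≤-reflexive (cong suc (sym (+-suc M j)))) M+j<L))

      -- (B + q^E H)² = B² + q^E (2BH + q^E H²) with all three parts separated; the cross
      -- term 2BH contributes (q − 1) ℓ once for the seed and once for each earlier block.
      digitSum-build² : ∀ i → i ≤ n → s (build i * build i) ≡ k * (y + (tri i + i) * M + (squares i + tri i))
      digitSum-build² zero    _   = trans digitSum-seed² (cong (k *_) (sym (trans (+-identityʳ (y + 0)) (+-identityʳ y))))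
      digitSum-build² (suc i) i<n = begin
        s ((B + P * H) * (B + P * H))                         ≡⟨ cong s (expand B P H) ⟩
        s (B * B + P * (2 * B * H + P * (H * H)))             ≡⟨ digitSum-concat (E i) (B * B) _ (square-bound i i≤n) ⟩
        s (B * B) + s (2 * B * H + P * (H * H))               ≡⟨ cong (s (B * B) +_) (digitSum-concat (E i) (2 * B * H) (H * H) (cross-bound i (ℓ i) i≤n (s≤s z≤n) (ℓ-bound i<n))) ⟩
        s (B * B) + (s (2 * B * H) + s (H * H))               ≡⟨ cong₂ _+_ (digitSum-build² i i≤n)
                                                                   (cong₂ _+_ (digitSum-cross i (ℓ i) ≤-refl (ℓ-bound i<n))
                                                                              (digitSum-multiple (ℓ i) (s≤s z≤n) (nines-bound (ℓ i) (s≤s z≤n)))) ⟩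
        k * (y + (tri i + i) * M + (squares i + tri i)) + (suc i * (k * ℓ i) + k * ℓ i)
                                                              ≡⟨ step k y i M (tri i) (squares i) ⟩
        k * (y + (tri (suc i) + suc i) * M + (squares (suc i) + tri (suc i))) ∎
        where
        open ≡-Reasoning
        i≤n : i ≤ n
        i≤n = <⇒≤ i<n
        B P H : ℕ
        B = build i
        P = q ^ E i
        H = nines (ℓ i)
        expand : ∀ b p h → (b + p * h) * (b + p * h) ≡ b * b + p * (2 * b * h + p * (h * h))
        expand = solve-∀
        step : ∀ k y i M t σ → k * (y + (t + i) * M + (σ + t)) + (suc i * (k * suc (M + i)) + k * suc (M + i))
                               ≡ k * (y + (t + suc i + suc i) * M + (σ + suc i * suc i + (t + suc i)))
        step = solve-∀

    -- a/b ≥ 3/2, written as 2a = e + (n + 2) b with n ≥ 1 and 0 ≤ e < b = e + f: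
    -- a chain of n blocks on a borrowed seed with C = 1.  The seed size P = A + 1 + τ,
    -- the gap and M below solve the linear system  s(v) = (q−1) b z,  s(v²) = (q−1) a z.
    witness-above : ∀ n₀ e f₀ a → 2 * a ≡ e + (3 + n₀) * (e + suc f₀) → Witness a (e + suc f₀)
    witness-above n₀ e f₀ a half = record
      { v = build n ; z = z ; z-pos = s≤s z≤n
      ; digitSum-v  = trans (digitSum-build n ≤-refl) (cong (k *_) sum-v)
      ; digitSum-v² = trans (digitSum-build² n ≤-refl) (cong (k *_) sum-v²)
      }
      where
      n f b t z M P gap τ D' A : ℕ
      n = suc n₀
      f = suc f₀
      b = e + f
      t = n + 3
      z = 4 * n * (n + 1) * (n + 2) * t
      M = 2 * t * (2 * (n * b + e) * (n + 2) + f)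
      P = t * f * n * (3 * n + 5)
      gap = t * f * n * (n + 1)
      τ = squares n + tri n
      D' = gap + 1 + squares n
      A = P ∸ (1 + τ)

      linear-v : ∀ n e f t → t * f * n * (3 * n + 5) + t * f * n * (n + 1) + n * (2 * t * (2 * (n * (e + f) + e) * (n + 2) + f))
                             ≡ (e + f) * (4 * n * (n + 1) * (n + 2) * t)
      linear-v = solve-∀
      linear-v² : ∀ n e f t → 2 * (t * f * n * (3 * n + 5)) + (n * (n + 1) + 2 * n) * (2 * t * (2 * (n * (e + f) + e) * (n + 2) + f))
                              ≡ (e + (n + 2) * (e + f)) * (4 * n * (n + 1) * (n + 2) * t)
      linear-v² = solve-∀
      M-split : ∀ n e f t → 2 * t * (2 * (n * (e + f) + e) * (n + 2) + f)
                            ≡ t * f * n * (3 * n + 5) + t * f * n * (n + 1) + (t * f * (2 * n + 2) + 4 * t * (n + 2) * (n * e + e))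
      M-split = solve-∀

      seed-room : suc D' + 1 + 1 + (1 + τ) ≤ P
      seed-room = begin
        suc D' + 1 + 1 + (1 + τ)                ≡⟨ collect gap (squares n) (tri n) ⟩
        gap + (5 + 2 * squares n + tri n)       ≤⟨ +-monoʳ-≤ gap small ⟩
        gap + t * f * n * (2 * n + 4)           ≡⟨ split t f n ⟩
        P                                       ∎
        where
        open ≤-Reasoning
        collect : ∀ g σ c → suc (g + 1 + σ) + 1 + 1 + (1 + (σ + c)) ≡ g + (5 + 2 * σ + c)
        collect = solve-∀
        split : ∀ t f n → t * f * n * (n + 1) + t * f * n * (2 * n + 4) ≡ t * f * n * (3 * n + 5)
        split = solve-∀
        cubic : ∀ n → 5 * n + 2 * (n * n * n) + n * n + (9 * (n * n) + 7 * n) ≡ (n + 3) * n * (2 * n + 4)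
        cubic = solve-∀
        reorder : ∀ t f n u → f * (t * n * u) ≡ t * f * n * u
        reorder = solve-∀
        small : 5 + 2 * squares n + tri n ≤ t * f * n * (2 * n + 4)
        small = begin
          5 + 2 * squares n + tri n                           ≤⟨ +-mono-≤ (+-mono-≤ (*-monoʳ-≤ 5 (s≤s z≤n)) (*-monoʳ-≤ 2 (squares-bound n))) (tri-bound n) ⟩
          5 * n + 2 * (n * n * n) + n * n                     ≤⟨ m≤m+n _ _ ⟩
          5 * n + 2 * (n * n * n) + n * n + (9 * (n * n) + 7 * n) ≡⟨ cubic n ⟩
          t * n * (2 * n + 4)                                 ≤⟨ m≤n*m (t * n * (2 * n + 4)) f ⟩
          f * (t * n * (2 * n + 4))                           ≡⟨ reorder t f n (2 * n + 4) ⟩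
          t * f * n * (2 * n + 4)                             ∎

      A-spec : A + (1 + τ) ≡ P
      A-spec = m∸n+n≡m (≤-trans (m≤n+m (1 + τ) (suc D' + 1 + 1)) seed-room)

      room : suc D' + 1 + 1 ≤ A
      room = m+n≤o⇒m≤o∸n (suc D' + 1 + 1) seed-room

      1<D : 1 < suc D'
      1<D = s≤s (≤-trans (m≤n+m 1 gap) (m≤m+n (gap + 1) (squares n)))

      open Borrowed A 1 (suc D') (s≤s z≤n) 1<D room using (w; w-pos; w-bound; digitSum-w; digitSum-w²)

      digitSum-seed : s w ≡ k * (A + D')
      digitSum-seed = +-cancelʳ-≡ (k * 1) _ _ (trans digitSum-w (shift k A D'))
        where
        shift : ∀ k a d → k * (a + suc d) ≡ k * (a + d) + k * 1
        shift = solve-∀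

      seed-bound : w < q ^ M
      seed-bound = ≤-trans w-bound (^-monoʳ-≤ q (+-cancelʳ-≤ (1 + τ) _ _ (begin
        A + suc D' + (1 + τ)                    ≡⟨ swap A (suc D') (1 + τ) ⟩
        A + (1 + τ) + suc D'                    ≡⟨ cong (_+ suc D') A-spec ⟩
        P + suc D'                              ≡⟨ unfold P gap (squares n) ⟩
        P + gap + 1 + (1 + squares n)           ≤⟨ +-monoˡ-≤ (1 + squares n) (+-monoʳ-≤ (P + gap) (s≤s z≤n)) ⟩
        P + gap + R + (1 + squares n)           ≤⟨ m≤m+n _ (tri n) ⟩
        P + gap + R + (1 + squares n) + tri n   ≡⟨ +-assoc (P + gap + R) (1 + squares n) (tri n) ⟩
        P + gap + R + (1 + τ)                   ≡⟨ cong (_+ (1 + τ)) (sym (M-split n e f t)) ⟩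
        M + (1 + τ)                             ∎)))
        where
        open ≤-Reasoning
        R : ℕ
        R = t * f * (2 * n + 2) + 4 * t * (n + 2) * (n * e + e)
        swap : ∀ a b c → a + b + c ≡ a + c + b
        swap = solve-∀
        unfold : ∀ p g σ → p + suc (g + 1 + σ) ≡ p + g + 1 + (1 + σ)
        unfold = solve-∀

      open Chain w (A + D') (A + 1) M n w-pos seed-bound digitSum-seed digitSum-w²

      sum-v : A + D' + n * M + tri n ≡ b * z
      sum-v = +-cancelʳ-≡ (1 + τ) _ _ (begin
        A + D' + n * M + tri n + (1 + τ)            ≡⟨ swap A D' (n * M) (tri n) (1 + τ) ⟩
        A + (1 + τ) + D' + n * M + tri n            ≡⟨ cong (λ u → u + D' + n * M + tri n) A-spec ⟩
        P + (gap + 1 + squares n) + n * M + tri n   ≡⟨ collect P gap (squares n) (n * M) (tri n) ⟩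
        P + gap + n * M + (1 + τ)                   ≡⟨ cong (_+ (1 + τ)) (linear-v n e f t) ⟩
        b * z + (1 + τ)                             ∎)
        where
        open ≡-Reasoning
        swap : ∀ a d m c u → a + d + m + c + u ≡ a + u + d + m + c
        swap = solve-∀
        collect : ∀ p g σ m c → p + (g + 1 + σ) + m + c ≡ p + g + m + (1 + (σ + c))
        collect = solve-∀

      sum-v² : A + 1 + (tri n + n) * M + (squares n + tri n) ≡ a * z
      sum-v² = begin
        A + 1 + (tri n + n) * M + (squares n + tri n)  ≡⟨ collect A (tri n) n M (squares n) ⟩
        A + (1 + τ) + (tri n + n) * M                  ≡⟨ cong (_+ (tri n + n) * M) A-spec ⟩
        P + (tri n + n) * M                            ≡⟨ *-cancelˡ-≡ _ _ 2 doubled ⟩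
        a * z                                          ∎
        where
        open ≡-Reasoning
        collect : ∀ a c n m σ → a + 1 + (c + n) * m + (σ + c) ≡ a + (1 + (σ + c)) + (c + n) * m
        collect = solve-∀
        distribute : ∀ p c n m → 2 * (p + (c + n) * m) ≡ 2 * p + (2 * c + 2 * n) * m
        distribute = solve-∀
        doubled : 2 * (P + (tri n + n) * M) ≡ 2 * (a * z)
        doubled = begin
          2 * (P + (tri n + n) * M)                ≡⟨ distribute P (tri n) n M ⟩
          2 * P + (2 * tri n + 2 * n) * M          ≡⟨ cong (λ u → 2 * P + (u + 2 * n) * M) (double-tri n) ⟩
          2 * P + (n * (n + 1) + 2 * n) * M        ≡⟨ linear-v² n e f t ⟩
          (e + (n + 2) * b) * z                    ≡⟨ cong (λ u → (e + u * b) * z) (+-comm n 2) ⟩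
          (e + (3 + n₀) * b) * z                   ≡⟨ cong (_* z) (sym half) ⟩
          2 * a * z                                ≡⟨ *-assoc 2 a z ⟩
          2 * (a * z)                              ∎

    witness-from-quotient : ∀ Q e f₀ a → 2 * a ≡ e + Q * (e + suc f₀) → e + suc f₀ < 2 * a →
                            Witness a (e + suc f₀)
    witness-from-quotient zero e f₀ a half b<2a
      with () ← +-cancelˡ-< e (suc f₀) 0 (subst (e + suc f₀ <_) half b<2a)
    witness-from-quotient (suc zero) zero f₀ a half b<2a =
      ⊥-elim (<-irrefl (sym (+-identityʳ (suc f₀))) (subst (suc f₀ <_) half b<2a))
    witness-from-quotient (suc zero) (suc e₀) f₀ a half _ = witness-below e₀ f₀ a half
    witness-from-quotient 2 e f₀ a half _ = witness-middle e f₀ a half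
    witness-from-quotient (suc (suc (suc n₀))) e f₀ a half _ = witness-above n₀ e f₀ a half

    witness : ∀ a d → suc d < 2 * a → Witness a (suc d)
    witness a d b<2a =
      subst (Witness a) b-split (witness-from-quotient Q e f₀ a half (subst (_< 2 * a) (sym b-split) b<2a))
      where
      b Q e f₀ : ℕ
      b = suc d
      Q = 2 * a / b
      e = 2 * a % b
      f₀ = b ∸ suc e
      b-split : e + suc f₀ ≡ b
      b-split = trans (+-suc e f₀) (m+[n∸m]≡n (m%n<n (2 * a) b))
      half : 2 * a ≡ e + Q * (e + suc f₀)
      half = trans (m≡m%n+[m/n]*n (2 * a) b) (cong (λ u → e + Q * u) (sym b-split))

    record Realised (a b : ℕ) : Set where
      field
        v        : ℕ
        positive : 1 ≤ s v
        ratio    : s (v * v) * b ≡ a * s v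

    realise : ∀ a d → suc d < 2 * a → Realised a (suc d)
    realise a d b<2a = record { v = v ; positive = positive ; ratio = ratio }
      where
      open Witness (witness a d b<2a)
      positive : 1 ≤ s v
      positive = subst (1 ≤_) (sym digitSum-v) (*-mono-≤ {1} {k} (s≤s z≤n) (*-mono-≤ {1} {suc d} (s≤s z≤n) z-pos))
      ratio : s (v * v) * suc d ≡ a * s v
      ratio = trans (cong (_* suc d) digitSum-v²) (trans (regroup k a z (suc d)) (cong (a *_) (sym digitSum-v)))
        where
        regroup : ∀ k a z b → k * (a * z) * b ≡ a * (k * (b * z))
        regroup = solve-∀

module Rationals where
  open import Data.Nat as ℕ using (suc)
  import Data.Nat.Properties as ℕ
  open import Data.Integer as ℤ using (+_; -[1+_])
  import Data.Integer.Properties as ℤ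
  open import Data.Rational using (mkℚ; _/_; _<_; ½; *<*)
  open import Data.Rational.Properties using (fromℚᵘ-cong; fromℚᵘ-toℚᵘ)
  import Data.Rational.Unnormalised as ℚᵘ
  open import Data.Nat.Coprimality using (Coprime)
  open import Data.Empty using (⊥)
  open import Relation.Binary.PropositionalEquality

  above-half : ∀ a d .(c : Coprime a (suc d)) → ½ < mkℚ (+ a) d c → suc d ℕ.< 2 ℕ.* a
  above-half a d c (*<* p) = ℤ.drop‿+<+ (subst₂ ℤ._<_ (ℤ.*-identityˡ (+ suc d)) numerator p)
    where
    numerator : + a ℤ.* + 2 ≡ + (2 ℕ.* a)
    numerator = trans (sym (ℤ.pos-* a 2)) (cong +_ (ℕ.*-comm a 2))

  negative-not-above-half : ∀ a d .(c : Coprime (suc a) (suc d)) → ½ < mkℚ -[1+ a ] d c → ⊥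
  negative-not-above-half a d c (*<* p) with () ← subst (ℤ._< -[1+ a ] ℤ.* + 2) (ℤ.*-identityˡ (+ suc d)) p

  fraction : ∀ N D a d .(c : Coprime a (suc d)) .{{_ : ℕ.NonZero D}} →
             N ℕ.* suc d ≡ a ℕ.* D → (+ N) / D ≡ mkℚ (+ a) d c
  fraction N (suc D) a d c eq =
    trans (fromℚᵘ-cong {ℚᵘ.mkℚᵘ (+ N) D} {ℚᵘ.mkℚᵘ (+ a) d} (ℚᵘ.*≡* cross)) (fromℚᵘ-toℚᵘ (mkℚ (+ a) d c))
    where
    cross : + N ℤ.* + suc d ≡ + a ℤ.* + suc D
    cross = trans (sym (ℤ.pos-* N (suc d))) (trans (cong +_ eq) (ℤ.pos-* a (suc D)))

open import Data.Nat using (ℕ; _*_; _≤_; NonZero)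
open import Data.Integer using (+_)
open import Data.Rational using (ℚ; _/_; _<_; ½)
open import Data.Product using (Σ)
open import Relation.Binary.PropositionalEquality using (_≡_)
open import Data.Nat using (suc; s≤s; >-nonZero)
open import Data.Integer using (-[1+_])
open import Data.Rational using (mkℚ)
open import Data.Product using (_,_)
open import Data.Empty using (⊥-elim)
open DigitSums using (module Construction)
open Rationals

theorem3p16 : (q : ℕ) → .{{_ : NonZero q}} → 3 ≤ q → (r : ℚ) → ½ < r →
    Σ ℕ (λ v → Σ (NonZero (digitSum q v)) (λ nz →
    _/_ (+ digitSum q (v * v)) (digitSum q v) {{nz}} ≡ r))
theorem3p16 (suc (suc (suc c))) (s≤s (s≤s (s≤s _))) (mkℚ (+ a) d coprime) ½<r =
  v , nonZero , fraction (digitSum (suc (suc (suc c))) (v * v)) (digitSum (suc (suc (suc c))) v) a d coprime {{nonZero}} ratio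
  where
  open Construction c using (Realised; realise)
  open Realised (realise a d (above-half a d coprime ½<r))
  nonZero : NonZero (digitSum (suc (suc (suc c))) v)
  nonZero = >-nonZero positive
theorem3p16 (suc (suc (suc c))) (s≤s (s≤s (s≤s _))) (mkℚ -[1+ a ] d coprime) ½<r =
  ⊥-elim (negative-not-above-half a d coprime ½<r)
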